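{- If $\vdash \Gamma$ is derivable in $\mathsf{MLL}_\mathbf{J}$, then $\Gamma$ can be partitioned into $\Delta,\Theta_\mathbf{J}$ such that every formula in $\Delta$ is an $\mathsf{MLL}_\mathbf{J}$-formula and every formula in $\Theta_\mathbf{J}$ is $\mathbf{J}^\perp$.
   Context: $\mathsf{MLL}$ formulas are built from atoms $A$, their negations $A^\perp$, tensor $\otimes$ and par $⅋$ (the multiplicative disjunction). $\mathbf{J}$ is a special atom not occurring in ordinary $\mathsf{MLL}$ formulas. $J$-formulas are $\mathbf{J}$ or $\mathbf{J}^\perp$, and $J$-environments $\Theta_\mathbf{J}$ are lists of $J$-formulas. $\mathsf{MLL}_\mathbf{J}$ is the cut-free sequent calculus with the $\mathsf{MLL}$ rules (axiom $\vdash A,A^\perp$, par, tensor), except that $J$-formulas are kept separate until used, through the following rules. (i) $\otimes_\mathbf{J}$ rule: from $\vdash \Gamma, F, \Theta_\mathbf{J}$ and the axiom $\vdash \mathbf{J},\mathbf{J}^\perp$, derive $\vdash \Gamma, F\otimes\mathbf{J}, \mathbf{J}^\perp, \Theta_\mathbf{J}$, where $F$ is not a $J$-formula. (ii) ⅋$_{\mathbf{J}^\perp}$ rule: from $\vdash \Gamma, F, \mathbf{J}^\perp, \Theta_\mathbf{J}$ derive $\vdash \Gamma, F ⅋ \mathbf{J}^\perp, \Theta_\mathbf{J}$, where $F$ is not a $J$-formula. $\mathsf{MLL}_\mathbf{J}$-formulas are given by the grammar $F_J ::= A \mid F_J ⅋ F_J \mid F_J\otimes F_J \mid F_J ⅋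 \mathbf{J}^\perp \mid F_J\otimes\mathbf{J}$. -}

module Defs where

open import Data.Nat using (ℕ)
open import Data.Empty using (⊥)
open import Data.List using (List; []; _∷_; _++_)
open import Data.List.Relation.Unary.All using (All)
open import Data.List.Relation.Binary.Permutation.Propositional using (_↭_)

data Formula : Set where
  atom  : ℕ → Formula
  natom : ℕ → Formula
  _⊗_   : Formula → Formula → Formula
  _⅋_   : Formula → Formula → Formula
  J     : Formula
  J⊥    : Formula

data IsJ : Formula → Set where
  isJ  : IsJ J
  isJ⊥ : IsJ J⊥

JEnv : List Formula → Set
JEnv Θ = All IsJ Θ

NotJ : Formula → Set
NotJ F = IsJ F → ⊥

data IsMLLJ : Formula → Set where
  m-atom  : ∀ a → IsMLLJ (atom a)
  m-natom : ∀ a → IsMLLJ (natom a)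
  m-par   : ∀ {F G} → IsMLLJ F → IsMLLJ G → IsMLLJ (F ⅋ G)
  m-ten   : ∀ {F G} → IsMLLJ F → IsMLLJ G → IsMLLJ (F ⊗ G)
  m-parJ  : ∀ {F} → IsMLLJ F → IsMLLJ (F ⅋ J⊥)
  m-tenJ  : ∀ {F} → IsMLLJ F → IsMLLJ (F ⊗ J)

data ⊢_ : List Formula → Set where
  ax    : ∀ a → ⊢ (atom a ∷ natom a ∷ [])
  exch  : ∀ {Γ Δ} → Γ ↭ Δ → ⊢ Γ → ⊢ Δ
  par   : ∀ {Γ F G} → NotJ F → NotJ G →
          ⊢ (Γ ++ F ∷ G ∷ []) → ⊢ (Γ ++ (F ⅋ G) ∷ [])
  ten   : ∀ {Γ Δ F G} → NotJ F → NotJ G →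
          ⊢ (Γ ++ F ∷ []) → ⊢ (Δ ++ G ∷ []) → ⊢ (Γ ++ Δ ++ (F ⊗ G) ∷ [])
  -- ⊗_J : from ⊢ Γ, F, Θ_J and the axiom ⊢ J, J⊥ derive ⊢ Γ, F⊗J, J⊥, Θ_J
  tenJ  : ∀ {Γ F Θ} → NotJ F → JEnv Θ →
          ⊢ (Γ ++ F ∷ Θ) → ⊢ (Γ ++ (F ⊗ J) ∷ J⊥ ∷ Θ)
  parJ⊥ : ∀ {Γ F Θ} → NotJ F → JEnv Θ →
          ⊢ (Γ ++ F ∷ J⊥ ∷ Θ) → ⊢ (Γ ++ (F ⅋ J⊥) ∷ Θ)

-- Each formula of a derivable sequent is an MLL_J-formula or J⊥: the only J-formula a
-- rule creates is the J⊥ of ⊗_J, the J of ⊗_J is at once buried in F ⊗ J, and every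
-- other principal formula is built from non-J premises, which by induction are MLL_J.
-- Sorting the sequent into these two classes gives the partition.
module Submission where

open import Defs
open import Data.List using (List; _++_; []; _∷_)
open import Data.List.Relation.Unary.All using (All; []; _∷_)
open import Data.List.Relation.Unary.All.Properties using (++⁺; ++⁻ˡ; ++⁻ʳ)
open import Data.List.Relation.Binary.Permutation.Propositional
  using (_↭_; ↭-sym; ↭-trans; ↭-refl; prep)
open import Data.List.Relation.Binary.Permutation.Propositional.Properties
  using (All-resp-↭; shift)
open import Data.Product using (Σ; _×_; _,_)
open import Data.Sum using (_⊎_; inj₁; inj₂)
open import Data.Empty using (⊥-elim)
open import Relation.Binary.PropositionalEquality using (_≡_; refl)

partition-↭ : ∀ {a p q} {A : Set a} {P : A → Set p} {Q : A → Set q} →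
  (xs : List A) → All (λ x → P x ⊎ Q x) xs →
  Σ (List A) λ ys → Σ (List A) λ zs → (xs ↭ ys ++ zs) × All P ys × All Q zs
partition-↭ []       []            = [] , [] , ↭-refl , [] , []
partition-↭ (x ∷ xs) (px⊎qx ∷ all) with partition-↭ xs all
... | ys , zs , xs↭ , Pys , Qzs with px⊎qx
...   | inj₁ px = x ∷ ys , zs , prep x xs↭ , px ∷ Pys , Qzs
...   | inj₂ qx = ys , x ∷ zs , ↭-trans (prep x xs↭) (↭-sym (shift x ys zs))
                , Pys , qx ∷ Qzs

IsMLLJOrJ⊥ : Formula → Set
IsMLLJOrJ⊥ F = IsMLLJ F ⊎ F ≡ J⊥

notJ-isMLLJ : ∀ {F} → NotJ F → IsMLLJOrJ⊥ F → IsMLLJ F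
notJ-isMLLJ _  (inj₁ mF)   = mF
notJ-isMLLJ ¬J (inj₂ refl) = ⊥-elim (¬J isJ⊥)

derivable⇒All-IsMLLJOrJ⊥ : ∀ {Γ} → ⊢ Γ → All IsMLLJOrJ⊥ Γ
derivable⇒All-IsMLLJOrJ⊥ (ax a) = inj₁ (m-atom a) ∷ inj₁ (m-natom a) ∷ []
derivable⇒All-IsMLLJOrJ⊥ (exch Γ↭Δ d) = All-resp-↭ Γ↭Δ (derivable⇒All-IsMLLJOrJ⊥ d)
derivable⇒All-IsMLLJOrJ⊥ (par {Γ} ¬JF ¬JG d)
  with F ∷ G ∷ [] ← ++⁻ʳ Γ (derivable⇒All-IsMLLJOrJ⊥ d) =
  ++⁺ (++⁻ˡ Γ (derivable⇒All-IsMLLJOrJ⊥ d))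
      (inj₁ (m-par (notJ-isMLLJ ¬JF F) (notJ-isMLLJ ¬JG G)) ∷ [])
derivable⇒All-IsMLLJOrJ⊥ (ten {Γ} {Δ} ¬JF ¬JG d e)
  with F ∷ [] ← ++⁻ʳ Γ (derivable⇒All-IsMLLJOrJ⊥ d)
     | G ∷ [] ← ++⁻ʳ Δ (derivable⇒All-IsMLLJOrJ⊥ e) =
  ++⁺ (++⁻ˡ Γ (derivable⇒All-IsMLLJOrJ⊥ d))
      (++⁺ (++⁻ˡ Δ (derivable⇒All-IsMLLJOrJ⊥ e))
           (inj₁ (m-ten (notJ-isMLLJ ¬JF F) (notJ-isMLLJ ¬JG G)) ∷ []))
derivable⇒All-IsMLLJOrJ⊥ (tenJ {Γ} ¬JF _ d)
  with F ∷ Θ ← ++⁻ʳ Γ (derivable⇒All-IsMLLJOrJ⊥ d) =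
  ++⁺ (++⁻ˡ Γ (derivable⇒All-IsMLLJOrJ⊥ d))
      (inj₁ (m-tenJ (notJ-isMLLJ ¬JF F)) ∷ inj₂ refl ∷ Θ)
derivable⇒All-IsMLLJOrJ⊥ (parJ⊥ {Γ} ¬JF _ d)
  with F ∷ _ ∷ Θ ← ++⁻ʳ Γ (derivable⇒All-IsMLLJOrJ⊥ d) =
  ++⁺ (++⁻ˡ Γ (derivable⇒All-IsMLLJOrJ⊥ d))
      (inj₁ (m-parJ (notJ-isMLLJ ¬JF F)) ∷ Θ)

proposition3p2 : (Γ : List Formula) → ⊢ Γ →
    Σ (List Formula) λ Δ → Σ (List Formula) λ Θ →
      (Γ ↭ Δ ++ Θ) × All IsMLLJ Δ × All (λ X → X ≡ J⊥) Θ
proposition3p2 Γ ⊢Γ = partition-↭ Γ (derivable⇒All-IsMLLJOrJ⊥ ⊢Γ)
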